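{- Let $G$ be a prereduced graph, let $P=(v_0v_1\dots v_p)$ be a chordless (induced) path of length $p$ in $G$, and let $u$ be a vertex adjacent to every inner vertex $v_1,\dots,v_{p-1}$ of $P$. (1) If $p\ge 4$ and $u$ is also adjacent to $v_0$ and $v_p$, then $N[v_\ell]\subseteq N[u]$ for every $2\le \ell\le p-2$. (2) If $p\ge 3$ and $u$ is also adjacent to $v_0$ and $v_p$, then $N[v_\ell]\cap N[v_{\ell+1}]\subseteq N[u]$ for every $1\le\ell\le p-2$. (3) If $p\ge 4$, then $N[v_\ell]\setminus\big(N(v_1)\cup N(v_{p-1})\big)\subseteq N[u]$ for every $2\le\ell\le p-2$.
   Context: Graphs are finite, simple, undirected; $N(v)$ and $N[v]=N(v)\cup\{v\}$ are the open and closed neighborhoods. A set $X\subseteq V(G)$ is a minimal forbidden set if $G[X]$ is not an interval graph but every proper subset of $X$ induces an interval graph. $G$ is prereduced if it has no minimal forbidden set with at most $10$ vertices. -}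

module Defs where

open import Data.Nat using (ℕ; zero; suc; _≤_; _∸_)
open import Data.Fin using (Fin; toℕ)
open import Data.Fin.Subset using (Subset; _∈_; _⊂_; ∣_∣)
open import Data.Bool using (Bool; true)
open import Data.Product using (Σ; _×_; ∃)
open import Data.Sum using (_⊎_)
open import Relation.Binary.PropositionalEquality using (_≡_; _≢_)
open import Relation.Nullary using (¬_)
open import Function.Bundles using (_⇔_)

record Graph (n : ℕ) : Set where
  field
    adj   : Fin n → Fin n → Bool
    sym   : ∀ x y → adj x y ≡ adj y x
    irref : ∀ x → ¬ (adj x x ≡ true)
open Graph public

module _ {n : ℕ} (G : Graph n) where

  Adj : Fin n → Fin n → Set
  Adj x y = adj G x y ≡ true

  N[_] : Fin n → Fin n → Set
  N[ x ] y = y ≡ x ⊎ Adj x y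

  N⟨_⟩ : Fin n → Fin n → Set
  N⟨ x ⟩ y = Adj x y

  Interval : Set
  Interval = ℕ × ℕ

  Intersect : Interval → Interval → Set
  Intersect (l₁ Data.Product., r₁) (l₂ Data.Product., r₂) = l₁ ≤ r₂ × l₂ ≤ r₁

  IsIntervalInduced : Subset n → Set
  IsIntervalInduced X =
    Σ (Fin n → Interval) λ I →
      (∀ x → x ∈ X → Data.Product.proj₁ (I x) ≤ Data.Product.proj₂ (I x)) ×
      (∀ x y → x ∈ X → y ∈ X → x ≢ y → (Adj x y ⇔ Intersect (I x) (I y)))

  MinimalForbidden : Subset n → Set
  MinimalForbidden X = ¬ IsIntervalInduced X × (∀ Y → Y ⊂ X → IsIntervalInduced Y)

  Prereduced : Set
  Prereduced = ∀ X → ∣ X ∣ ≤ 10 → ¬ MinimalForbidden X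

  ChordlessPath : (p : ℕ) → (Fin (suc p) → Fin n) → Set
  ChordlessPath p v =
    (∀ i j → v i ≡ v j → i ≡ j) ×
    (∀ i j → Adj (v i) (v j) ⇔ (suc (toℕ i) ≡ toℕ j ⊎ suc (toℕ j) ≡ toℕ i))

-- In a prereduced graph every set of at most ten vertices induces an interval graph,
-- so there is no induced C4 and no asteroidal triple spanning at most ten vertices.
-- Let x ∉ N[u]. If x sees w₁ and w₂ of an induced P4 w₀w₁w₂w₃ on the path
-- dominated by u, an edge from x to w₀ or w₃ closes an induced C4 through u, and otherwise
-- {w₀, x, w₃} is an asteroidal triple (joined by w₀w₁x, xw₂w₃ and w₀uw₃). If x sees only
-- the centre of an induced P5 w₀…w₄ whose inner vertices u dominates, an edge to w₀ or w₄
-- again closes an induced C4, and otherwise {w₀, x, w₄} is an asteroidal triple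
-- (joined by w₀w₁w₂x, xw₂w₃w₄ and w₀w₁uw₃w₄). Interval models are only obtained under
-- double negation, which suffices because membership in N[u] is decidable.

module Submission where

open import Defs
open import Data.Nat using (ℕ; zero; suc; _≤_; _∸_; _<_; _+_; z≤n; s≤s; _≤?_; _≟_)
open import Data.Nat.Properties
open import Data.Fin using (Fin; toℕ; fromℕ; fromℕ<)
open import Data.Fin.Patterns using (0F; 1F; 2F; 3F; 4F)
open import Data.Fin.Properties using (toℕ-fromℕ<; toℕ-fromℕ; toℕ-injective; toℕ≤pred[n]) renaming (_≟_ to _≟ᶠ_)
open import Data.Fin.Subset using (Subset; _∈_; ∣_∣; ⁅_⁆; _∪_) renaming (⊥ to ∅)
open import Data.Fin.Subset.Properties using (x∈⁅x⁆; p⊆p∪q; q⊆p∪q; ∣⊥∣≡0; ∣⁅x⁆∣≡1; p⊂q⇒∣p∣<∣q∣)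
open import Data.Vec using ([]; _∷_)
open import Data.List using (List; []; _∷_; length)
open import Data.List.Relation.Unary.Any using (here; there)
import Data.List.Membership.Propositional as List
open import Data.Bool using (true; false) renaming (_≟_ to _≟ᵇ_)
open import Data.Product using (_×_; _,_; proj₁; proj₂)
open import Data.Sum using (_⊎_; inj₁; inj₂; [_,_]′)
import Data.Sum
open import Data.Empty using (⊥; ⊥-elim)
open import Relation.Binary.PropositionalEquality using (_≡_; _≢_; refl; trans; cong; subst; module ≡-Reasoning) renaming (sym to ≡-sym)
open import Relation.Nullary using (¬_; yes; no; Dec)
open import Relation.Nullary.Decidable using (True; False; toWitness; toWitnessFalse; decidable-stable; _⊎-dec_)
open import Function using (_∘_)
open import Function.Bundles using (_⇔_; Equivalence; mk⇔)
open import Function.Properties.Equivalence using () renaming (trans to ⇔-trans)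

∣p∪q∣≤∣p∣+∣q∣ : ∀ {n} (p q : Subset n) → ∣ p ∪ q ∣ ≤ ∣ p ∣ + ∣ q ∣
∣p∪q∣≤∣p∣+∣q∣ []          []          = z≤n
∣p∪q∣≤∣p∣+∣q∣ (true ∷ p)  (true ∷ q)  = s≤s (≤-trans (∣p∪q∣≤∣p∣+∣q∣ p q) (+-monoʳ-≤ ∣ p ∣ (n≤1+n _)))
∣p∪q∣≤∣p∣+∣q∣ (true ∷ p)  (false ∷ q) = s≤s (∣p∪q∣≤∣p∣+∣q∣ p q)
∣p∪q∣≤∣p∣+∣q∣ (false ∷ p) (true ∷ q)  = ≤-trans (s≤s (∣p∪q∣≤∣p∣+∣q∣ p q)) (≤-reflexive (≡-sym (+-suc ∣ p ∣ ∣ q ∣)))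
∣p∪q∣≤∣p∣+∣q∣ (false ∷ p) (false ∷ q) = ∣p∪q∣≤∣p∣+∣q∣ p q

fromList : ∀ {n} → List (Fin n) → Subset n
fromList []      = ∅
fromList (x ∷ L) = ⁅ x ⁆ ∪ fromList L

∣fromList∣≤length : ∀ {n} (L : List (Fin n)) → ∣ fromList L ∣ ≤ length L
∣fromList∣≤length {n} [] = ≤-reflexive (∣⊥∣≡0 n)
∣fromList∣≤length (x ∷ L) = ≤-trans (∣p∪q∣≤∣p∣+∣q∣ ⁅ x ⁆ (fromList L))
  (+-mono-≤ (≤-reflexive (∣⁅x⁆∣≡1 x)) (∣fromList∣≤length L))

∈-fromList : ∀ {n} (L : List (Fin n)) {y} → y List.∈ L → y ∈ fromList L
∈-fromList (y ∷ L) (here refl)  = p⊆p∪q (fromList L) (x∈⁅x⁆ y)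
∈-fromList (x ∷ L) (there y∈L) = q⊆p∪q ⁅ x ⁆ (fromList L) (∈-fromList L y∈L)

¬¬-∀-Subset : ∀ {n} {Q : Subset n → Set} → (∀ Y → ¬ ¬ Q Y) → ¬ ¬ (∀ Y → Q Y)
¬¬-∀-Subset {zero}  ¬¬Q ¬∀ = ¬¬Q [] λ q → ¬∀ λ { [] → q }
¬¬-∀-Subset {suc n} ¬¬Q ¬∀ =
  ¬¬-∀-Subset {n} {λ Y → _ × _}
    (λ Y ¬both → ¬¬Q (true ∷ Y) λ q₁ → ¬¬Q (false ∷ Y) λ q₀ → ¬both (q₁ , q₀))
    (λ both → ¬∀ λ { (true ∷ Y) → proj₁ (both Y) ; (false ∷ Y) → proj₂ (both Y) })

module _ {n : ℕ} (G : Graph n) where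

  Adj-sym : ∀ {x y} → Adj G x y → Adj G y x
  Adj-sym {x} {y} = trans (Graph.sym G y x)

  Adj? : ∀ x y → Dec (Adj G x y)
  Adj? x y = adj G x y ≟ᵇ true

  N[]-stable : ∀ {x y} → ¬ ¬ N[ G ] x y → N[ G ] x y
  N[]-stable {x} {y} = decidable-stable (y ≟ᶠ x ⊎-dec Adj? x y)

  ∉N[]-sym : ∀ {x y} → ¬ N[ G ] x y → ¬ N[ G ] y x
  ∉N[]-sym y∉N[x] = [ (λ x≡y → y∉N[x] (inj₁ (≡-sym x≡y))) , (λ yx → y∉N[x] (inj₂ (Adj-sym yx))) ]′

  ∉N[]-via : ∀ {u x y} → Adj G u y → ¬ N[ G ] u x → ¬ Adj G y x → ¬ N[ G ] y x
  ∉N[]-via uy x∉N[u] yx = [ (λ { refl → x∉N[u] (inj₂ uy) }) , yx ]′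

  adjacent-to-all : ∀ {p u} {v : Fin (suc p) → Fin n} →
    Adj G u (v Fin.zero) → Adj G u (v (fromℕ p)) → (∀ i → 1 ≤ toℕ i → toℕ i ≤ p ∸ 1 → Adj G u (v i)) →
    ∀ i → Adj G u (v i)
  adjacent-to-all u~v₀ u~vₚ u~inner Fin.zero = u~v₀
  adjacent-to-all {p} {u} {v} u~v₀ u~vₚ u~inner (Fin.suc i) with toℕ (Fin.suc i) ≟ p
  ... | yes i+1≡p = subst (λ j → Adj G u (v j)) (toℕ-injective (trans (toℕ-fromℕ p) (≡-sym i+1≡p))) u~vₚ
  ... | no i+1≢p  = u~inner (Fin.suc i) (s≤s z≤n) (∸-monoˡ-≤ 1 (≤∧≢⇒< (toℕ≤pred[n] (Fin.suc i)) i+1≢p))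

module IntervalModel {n : ℕ} {G : Graph n} {X : Subset n} (M : IsIntervalInduced G X) where

  left right : Fin n → ℕ
  left x = proj₁ (proj₁ M x)
  right x = proj₂ (proj₁ M x)

  left≤right : ∀ {x} → x ∈ X → left x ≤ right x
  left≤right x∈X = proj₁ (proj₂ M) _ x∈X

  Adj⇔Intersect : ∀ {x y} → x ∈ X → y ∈ X → x ≢ y → Adj G x y ⇔ Intersect G (proj₁ M x) (proj₁ M y)
  Adj⇔Intersect x∈X y∈X = proj₂ (proj₂ M) _ _ x∈X y∈X

  Adj⇒Intersect : ∀ {x y} → x ∈ X → y ∈ X → Adj G x y → left x ≤ right y × left y ≤ right x
  Adj⇒Intersect {x} x∈X y∈X xy = Equivalence.to (Adj⇔Intersect x∈X y∈X λ { refl → irref G x xy }) xy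

  _≺_ : Fin n → Fin n → Set
  x ≺ y = right x < left y

  ≺-irrefl : ∀ {x} → x ∈ X → ¬ x ≺ x
  ≺-irrefl x∈X x≺x = <⇒≱ x≺x (left≤right x∈X)

  ≺-trans : ∀ {x y z} → y ∈ X → x ≺ y → y ≺ z → x ≺ z
  ≺-trans y∈X x≺y y≺z = <-trans (<-≤-trans x≺y (left≤right y∈X)) y≺z

  ≺⇒¬Adj : ∀ {x y} → x ∈ X → y ∈ X → x ≺ y → ¬ Adj G x y
  ≺⇒¬Adj x∈X y∈X x≺y xy = <⇒≱ x≺y (proj₂ (Adj⇒Intersect x∈X y∈X xy))

  ≺-or-≻ : ∀ {x y} → x ∈ X → y ∈ X → ¬ N[ G ] x y → x ≺ y ⊎ y ≺ x
  ≺-or-≻ {x} {y} x∈X y∈X y∉N[x] with left x ≤? right y | left y ≤? right x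
  ... | yes lx≤ry | yes ly≤rx = ⊥-elim (y∉N[x] (inj₂
          (Equivalence.from (Adj⇔Intersect x∈X y∈X λ x≡y → y∉N[x] (inj₁ (≡-sym x≡y))) (lx≤ry , ly≤rx))))
  ... | yes _     | no ly≰rx = inj₁ (≰⇒> ly≰rx)
  ... | no lx≰ry  | _        = inj₂ (≰⇒> lx≰ry)

  straddlers-meet : ∀ {x y s t} → x ∈ X → y ∈ X → s ∈ X → t ∈ X → x ≺ y →
    Adj G x s → Adj G s y → Adj G x t → Adj G t y → s ≢ t → Adj G s t
  straddlers-meet x∈X y∈X s∈X t∈X x≺y xs sy xt ty s≢t =
    Equivalence.from (Adj⇔Intersect s∈X t∈X s≢t)
      ( ≤-trans (proj₂ (Adj⇒Intersect x∈X s∈X xs)) (<⇒≤ (<-≤-trans x≺y (proj₂ (Adj⇒Intersect t∈X y∈X ty))))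
      , ≤-trans (proj₂ (Adj⇒Intersect x∈X t∈X xt)) (<⇒≤ (<-≤-trans x≺y (proj₂ (Adj⇒Intersect s∈X y∈X sy)))))

  no-induced-C4 : ∀ {a b c d} → a ∈ X → b ∈ X → c ∈ X → d ∈ X →
    Adj G a b → Adj G b c → Adj G c d → Adj G d a → ¬ N[ G ] a c → ¬ N[ G ] b d → ⊥
  no-induced-C4 {a} {b} {c} {d} a∈X b∈X c∈X d∈X ab bc cd da c∉N[a] d∉N[b] =
    d∉N[b] (inj₂ (b~d (≺-or-≻ a∈X c∈X c∉N[a])))
    where
    b≢d : b ≢ d
    b≢d b≡d = d∉N[b] (inj₁ (≡-sym b≡d))
    b~d : a ≺ c ⊎ c ≺ a → Adj G b d
    b~d (inj₁ a≺c) = straddlers-meet a∈X c∈X b∈X d∈X a≺c ab bc (Adj-sym G da) (Adj-sym G cd) b≢d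
    b~d (inj₂ c≺a) = straddlers-meet c∈X a∈X b∈X d∈X c≺a (Adj-sym G bc) (Adj-sym G ab) cd da b≢d

  Outside : Fin n → Fin n → Set
  Outside m s = s ∈ X × ¬ N[ G ] m s

  data Walk (m : Fin n) : Fin n → Fin n → Set where
    [_]    : ∀ {s} → Outside m s → Walk m s s
    _∷⟨_⟩_ : ∀ {s w t} → Outside m s → Adj G s w → Walk m w t → Walk m s t

  infixr 5 _∷⟨_⟩_

  first : ∀ {m s t} → Walk m s t → Outside m s
  first [ o ]        = o
  first (o ∷⟨ _ ⟩ _) = o

  last : ∀ {m s t} → Walk m s t → Outside m t
  last [ o ]        = o
  last (_ ∷⟨ _ ⟩ W) = last W

  walk-left : ∀ {m s t} → m ∈ X → Walk m s t → s ≺ m → t ≺ m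
  walk-left m∈X [ _ ] s≺m = s≺m
  walk-left m∈X ((s∈X , _) ∷⟨ sw ⟩ W) s≺m with first W
  ... | w∈X , w∉N[m] with ≺-or-≻ m∈X w∈X w∉N[m]
  ...   | inj₁ m≺w = ⊥-elim (≺⇒¬Adj s∈X w∈X (≺-trans m∈X s≺m m≺w) sw)
  ...   | inj₂ w≺m = walk-left m∈X W w≺m

  walk-right : ∀ {m s t} → m ∈ X → Walk m s t → m ≺ s → m ≺ t
  walk-right m∈X [ _ ] m≺s = m≺s
  walk-right m∈X ((s∈X , _) ∷⟨ sw ⟩ W) m≺s with first W
  ... | w∈X , w∉N[m] with ≺-or-≻ m∈X w∈X w∉N[m]
  ...   | inj₁ m≺w = walk-right m∈X W m≺w
  ...   | inj₂ w≺m = ⊥-elim (≺⇒¬Adj w∈X s∈X (≺-trans m∈X w≺m m≺s) (Adj-sym G sw))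

  walk-¬left-right : ∀ {m s t} → m ∈ X → Walk m s t → s ≺ m → m ≺ t → ⊥
  walk-¬left-right m∈X W s≺m m≺t = ≺-irrefl m∈X (≺-trans (proj₁ (last W)) m≺t (walk-left m∈X W s≺m))

  walk-¬right-left : ∀ {m s t} → m ∈ X → Walk m s t → m ≺ s → t ≺ m → ⊥
  walk-¬right-left m∈X W m≺s t≺m = ≺-irrefl m∈X (≺-trans (proj₁ (last W)) (walk-right m∈X W m≺s) t≺m)

  -- Of three pairwise disjoint intervals one lies between the other two.
  no-asteroidal-triple : ∀ {x y z} → Walk z x y → Walk x y z → Walk y x z → ⊥
  no-asteroidal-triple Wz Wx Wy
    with first Wz | last Wz | last Wx | first Wy
  ... | x∈X , _ | y∈X , y∉N[z] | z∈X , z∉N[x] | _ , x∉N[y]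
    with ≺-or-≻ y∈X x∈X x∉N[y] | ≺-or-≻ z∈X y∈X y∉N[z] | ≺-or-≻ x∈X z∈X z∉N[x]
  ... | inj₂ x≺y | inj₂ y≺z | _        = walk-¬left-right y∈X Wy x≺y y≺z
  ... | inj₂ x≺y | inj₁ z≺y | inj₁ x≺z = walk-¬left-right z∈X Wz x≺z z≺y
  ... | inj₂ x≺y | inj₁ z≺y | inj₂ z≺x = walk-¬right-left x∈X Wx x≺y z≺x
  ... | inj₁ y≺x | inj₂ y≺z | inj₁ x≺z = walk-¬left-right x∈X Wx y≺x x≺z
  ... | inj₁ y≺x | inj₂ y≺z | inj₂ z≺x = walk-¬right-left z∈X Wz z≺x y≺z
  ... | inj₁ y≺x | inj₁ z≺y | _        = walk-¬right-left y∈X Wy y≺x z≺y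

Consecutive : ℕ → ℕ → Set
Consecutive m l = suc m ≡ l ⊎ suc l ≡ m

consecutive? : ∀ m l → Dec (Consecutive m l)
consecutive? m l = suc m ≟ l ⊎-dec suc l ≟ m

Consecutive-+ʳ : ∀ k {m l} → Consecutive (m + k) (l + k) ⇔ Consecutive m l
Consecutive-+ʳ k {m} {l} = mk⇔
  (Data.Sum.map (+-cancelʳ-≡ k (suc m) l) (+-cancelʳ-≡ k (suc l) m))
  (Data.Sum.map (cong (_+ k)) (cong (_+ k)))

window : ∀ {p q} (k : ℕ) → q + k ≤ p → Fin (suc q) → Fin (suc p)
window k q+k≤p i = fromℕ< (s≤s (≤-trans (+-monoˡ-≤ k (toℕ≤pred[n] i)) q+k≤p))

toℕ-window : ∀ {p q} k (h : q + k ≤ p) i → toℕ (window {p} k h i) ≡ toℕ i + k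
toℕ-window k h i = toℕ-fromℕ< _

≡window : ∀ {p q} k (h : q + k ≤ p) i {j} → toℕ j ≡ toℕ i + k → j ≡ window {p} k h i
≡window k h i j≡i+k = toℕ-injective (trans j≡i+k (≡-sym (toℕ-window k h i)))

window-bound : ∀ r s {m p} → r ≤ m → s ≤ p → m ≤ p ∸ s → r + s + (m ∸ r) ≤ p
window-bound r s {m} {p} r≤m s≤p m≤p∸s = begin
  r + s + (m ∸ r)   ≡⟨ cong (_+ (m ∸ r)) (+-comm r s) ⟩
  s + r + (m ∸ r)   ≡⟨ +-assoc s r (m ∸ r) ⟩
  s + (r + (m ∸ r)) ≡⟨ cong (s +_) (m+[n∸m]≡n r≤m) ⟩
  s + m             ≡⟨ +-comm s m ⟩
  m + s             ≤⟨ m≤o∸n⇒m+n≤o m s≤p m≤p∸s ⟩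
  p                 ∎
  where open ≤-Reasoning

module ChordlessPathFacts {n : ℕ} {G : Graph n} {p : ℕ} {v : Fin (suc p) → Fin n} (cp : ChordlessPath G p v) where

  edge : ∀ i j → {True (consecutive? (toℕ i) (toℕ j))} → Adj G (v i) (v j)
  edge i j {i~j} = Equivalence.from (proj₂ cp i j) (toWitness i~j)

  ∉N[] : ∀ i j → {False (j ≟ᶠ i)} → {False (consecutive? (toℕ i) (toℕ j))} → ¬ N[ G ] (v i) (v j)
  ∉N[] i j {j≢i} {i≁j} =
    [ (λ vj≡vi → toWitnessFalse j≢i (proj₁ cp j i vj≡vi))
    , (λ vi~vj → toWitnessFalse i≁j (Equivalence.to (proj₂ cp i j) vi~vj)) ]′

  window-chordless : ∀ {q} k (h : q + k ≤ p) → ChordlessPath G q (λ i → v (window k h i))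
  window-chordless k h = injective′ , adjacency′
    where
    injective′ : ∀ i j → v (window k h i) ≡ v (window k h j) → i ≡ j
    injective′ i j e = toℕ-injective (+-cancelʳ-≡ k _ _ (begin
      toℕ i + k            ≡⟨ ≡-sym (toℕ-window k h i) ⟩
      toℕ (window k h i)   ≡⟨ cong toℕ (proj₁ cp _ _ e) ⟩
      toℕ (window k h j)   ≡⟨ toℕ-window k h j ⟩
      toℕ j + k            ∎))
      where open ≡-Reasoning
    adjacency′ : ∀ i j → Adj G (v (window k h i)) (v (window k h j)) ⇔ Consecutive (toℕ i) (toℕ j)
    adjacency′ i j with proj₂ cp (window k h i) (window k h j)
    ... | iff rewrite toℕ-window k h i | toℕ-window k h j = ⇔-trans iff (Consecutive-+ʳ k)

module _ {n : ℕ} (G : Graph n) (prereduced : Prereduced G) where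

  small⇒¬¬interval : ∀ X → ∣ X ∣ ≤ 10 → ¬ ¬ IsIntervalInduced G X
  small⇒¬¬interval X ∣X∣≤10 = go (suc ∣ X ∣) X ≤-refl ∣X∣≤10
    where
    go : ∀ k Y → ∣ Y ∣ < k → ∣ Y ∣ ≤ 10 → ¬ ¬ IsIntervalInduced G Y
    go (suc k) Y (s≤s ∣Y∣≤k) ∣Y∣≤10 ¬interval =
      ¬¬-∀-Subset
        (λ Z ¬proper → ¬proper λ Z⊂Y →
          let ∣Z∣<∣Y∣ = p⊂q⇒∣p∣<∣q∣ Z⊂Y in
          ⊥-elim (go k Z (<-≤-trans ∣Z∣<∣Y∣ ∣Y∣≤k) (≤-trans (<⇒≤ ∣Z∣<∣Y∣) ∣Y∣≤10) λ z → ¬proper λ _ → z))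
        (λ proper → prereduced Y ∣Y∣≤10 (¬interval , proper))

  interval-on-list : (L : List (Fin n)) → {True (length L ≤? 10)} → ¬ ¬ IsIntervalInduced G (fromList L)
  interval-on-list L {≤10} = small⇒¬¬interval (fromList L) (≤-trans (∣fromList∣≤length L) (toWitness ≤10))

  no-induced-C4 : ∀ {a b c d} → Adj G a b → Adj G b c → Adj G c d → Adj G d a →
    ¬ N[ G ] a c → ¬ N[ G ] b d → ⊥
  no-induced-C4 {a} {b} {c} {d} ab bc cd da c∉N[a] d∉N[b] = interval-on-list L λ M →
    IntervalModel.no-induced-C4 {G = G} M (∈L (here refl)) (∈L (there (here refl)))
      (∈L (there (there (here refl)))) (∈L (there (there (there (here refl)))))
      ab bc cd da c∉N[a] d∉N[b]
    where
    L = a ∷ b ∷ c ∷ d ∷ []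
    ∈L = ∈-fromList L

  P4-common-neighbour : ∀ {w u x} → ChordlessPath G 3 w → (∀ i → Adj G u (w i)) →
    N[ G ] (w 1F) x → N[ G ] (w 2F) x → N[ G ] u x
  P4-common-neighbour cp u~ (inj₁ refl) _          = inj₂ (u~ 1F)
  P4-common-neighbour cp u~ (inj₂ _)   (inj₁ refl) = inj₂ (u~ 2F)
  P4-common-neighbour {w} {u} {x} cp u~ (inj₂ bx) (inj₂ cx) = N[]-stable G refute
    where
    open ChordlessPathFacts {G = G} cp
    refute : ¬ N[ G ] u x → ⊥
    refute x∉N[u] with Adj? G (w 0F) x | Adj? G (w 3F) x
    ... | yes ax | _      = no-induced-C4 (Adj-sym G ax) (Adj-sym G (u~ 0F)) (u~ 2F) cx
                              (∉N[]-sym G x∉N[u]) (∉N[] 0F 2F)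
    ... | no _   | yes dx = no-induced-C4 (Adj-sym G dx) (Adj-sym G (u~ 3F)) (u~ 1F) bx
                              (∉N[]-sym G x∉N[u]) (∉N[] 3F 1F)
    ... | no ¬ax | no ¬dx = interval-on-list L λ M →
      let open IntervalModel {G = G} M in
      no-asteroidal-triple
        ((a∈X , ∉N[] 3F 0F) ∷⟨ edge 0F 1F ⟩ (b∈X , ∉N[] 3F 1F) ∷⟨ bx ⟩ [ x∈X , x∉N[d] ])
        ((x∈X , x∉N[a]) ∷⟨ Adj-sym G cx ⟩ (c∈X , ∉N[] 0F 2F) ∷⟨ edge 2F 3F ⟩ [ d∈X , ∉N[] 0F 3F ])
        ((a∈X , ∉N[]-sym G x∉N[a]) ∷⟨ Adj-sym G (u~ 0F) ⟩ (u∈X , ∉N[]-sym G x∉N[u]) ∷⟨ u~ 3F ⟩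
          [ d∈X , ∉N[]-sym G x∉N[d] ])
      where
      L = w 0F ∷ w 1F ∷ w 2F ∷ w 3F ∷ u ∷ x ∷ []
      a∈X = ∈-fromList L (here refl)
      b∈X = ∈-fromList L (there (here refl))
      c∈X = ∈-fromList L (there (there (here refl)))
      d∈X = ∈-fromList L (there (there (there (here refl))))
      u∈X = ∈-fromList L (there (there (there (there (here refl)))))
      x∈X = ∈-fromList L (there (there (there (there (there (here refl))))))
      x∉N[a] = ∉N[]-via G (u~ 0F) x∉N[u] ¬ax
      x∉N[d] = ∉N[]-via G (u~ 3F) x∉N[u] ¬dx

  P5-private-neighbour : ∀ {w u x} → ChordlessPath G 4 w →
    Adj G u (w 1F) → Adj G u (w 2F) → Adj G u (w 3F) →
    Adj G (w 2F) x → ¬ Adj G (w 1F) x → ¬ Adj G (w 3F) x → N[ G ] u x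
  P5-private-neighbour {w} {u} {x} cp ub uc ud cx ¬bx ¬dx = N[]-stable G refute
    where
    open ChordlessPathFacts {G = G} cp
    b∉N[x] : ¬ N[ G ] u x → ¬ N[ G ] x (w 1F)
    b∉N[x] x∉N[u] = ∉N[]-sym G (∉N[]-via G ub x∉N[u] ¬bx)
    d∉N[x] : ¬ N[ G ] u x → ¬ N[ G ] x (w 3F)
    d∉N[x] x∉N[u] = ∉N[]-sym G (∉N[]-via G ud x∉N[u] ¬dx)
    refute : ¬ N[ G ] u x → ⊥
    refute x∉N[u] with Adj? G (w 0F) x | Adj? G (w 4F) x
    ... | yes ax | _      = no-induced-C4 (Adj-sym G ax) (edge 0F 1F) (edge 1F 2F) cx (b∉N[x] x∉N[u]) (∉N[] 0F 2F)
    ... | no _   | yes ex = no-induced-C4 (Adj-sym G ex) (edge 4F 3F) (edge 3F 2F) cx (d∉N[x] x∉N[u]) (∉N[] 4F 2F)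
    ... | no ¬ax | no ¬ex = interval-on-list L λ M →
      let open IntervalModel {G = G} M in
      no-asteroidal-triple
        ((a∈X , ∉N[] 4F 0F) ∷⟨ edge 0F 1F ⟩ (b∈X , ∉N[] 4F 1F) ∷⟨ edge 1F 2F ⟩ (c∈X , ∉N[] 4F 2F) ∷⟨ cx ⟩
          [ x∈X , ∉N[]-sym G x∉N[e] ])
        ((x∈X , ∉N[]-sym G x∉N[a]) ∷⟨ Adj-sym G cx ⟩ (c∈X , ∉N[] 0F 2F) ∷⟨ edge 2F 3F ⟩ (d∈X , ∉N[] 0F 3F)
          ∷⟨ edge 3F 4F ⟩ [ e∈X , ∉N[] 0F 4F ])
        ((a∈X , x∉N[a]) ∷⟨ edge 0F 1F ⟩ (b∈X , b∉N[x] x∉N[u]) ∷⟨ Adj-sym G ub ⟩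
          (u∈X , ∉N[]-sym G x∉N[u]) ∷⟨ ud ⟩ (d∈X , d∉N[x] x∉N[u]) ∷⟨ edge 3F 4F ⟩
          [ e∈X , x∉N[e] ])
      where
      L = w 0F ∷ w 1F ∷ w 2F ∷ w 3F ∷ w 4F ∷ u ∷ x ∷ []
      a∈X = ∈-fromList L (here refl)
      b∈X = ∈-fromList L (there (here refl))
      c∈X = ∈-fromList L (there (there (here refl)))
      d∈X = ∈-fromList L (there (there (there (here refl))))
      e∈X = ∈-fromList L (there (there (there (there (here refl)))))
      u∈X = ∈-fromList L (there (there (there (there (there (here refl))))))
      x∈X = ∈-fromList L (there (there (there (there (there (there (here refl)))))))
      x∉N[a] : ¬ N[ G ] x (w 0F)
      x∉N[a] = ∉N[]-via G cx (∉N[] 2F 0F) (¬ax ∘ Adj-sym G)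
      x∉N[e] : ¬ N[ G ] x (w 4F)
      x∉N[e] = ∉N[]-via G cx (∉N[] 2F 4F) (¬ex ∘ Adj-sym G)

  P5-centre : ∀ {w u x} → ChordlessPath G 4 w →
    Adj G u (w 1F) → Adj G u (w 2F) → Adj G u (w 3F) →
    (Adj G (w 1F) x → Adj G u (w 0F)) → (Adj G (w 3F) x → Adj G u (w 4F)) →
    N[ G ] (w 2F) x → N[ G ] u x
  P5-centre cp ub uc ud _ _ (inj₁ refl) = inj₂ uc
  P5-centre {w} {u} {x} cp ub uc ud bx⇒ua dx⇒ue (inj₂ cx) = by-cases (Adj? G (w 1F) x) (Adj? G (w 3F) x)
    where
    open ChordlessPathFacts {G = G} cp
    by-cases : Dec (Adj G (w 1F) x) → Dec (Adj G (w 3F) x) → N[ G ] u x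
    by-cases (yes bx) _        = P4-common-neighbour (window-chordless 0 (s≤s (s≤s (s≤s z≤n))))
                                   (λ { 0F → bx⇒ua bx ; 1F → ub ; 2F → uc ; 3F → ud }) (inj₂ bx) (inj₂ cx)
    by-cases (no _)   (yes dx) = P4-common-neighbour (window-chordless 1 ≤-refl)
                                   (λ { 0F → ub ; 1F → uc ; 2F → ud ; 3F → dx⇒ue dx }) (inj₂ cx) (inj₂ dx)
    by-cases (no ¬bx) (no ¬dx) = P5-private-neighbour cp ub uc ud cx ¬bx ¬dx

  module _ {p : ℕ} {v : Fin (suc p) → Fin n} (cp : ChordlessPath G p v) {u : Fin n} where
    open ChordlessPathFacts {G = G} cp

    N[vℓ]⊆N[u] : (∀ i → Adj G u (v i)) → 4 ≤ p →
      ∀ ℓ → 2 ≤ toℕ ℓ → toℕ ℓ ≤ p ∸ 2 → ∀ x → N[ G ] (v ℓ) x → N[ G ] u x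
    N[vℓ]⊆N[u] u~ 4≤p ℓ 2≤ℓ ℓ≤p-2 x x∈N[vℓ] =
      P5-centre (window-chordless k h) (u~ _) (u~ _) (u~ _) (λ _ → u~ _) (λ _ → u~ _)
        (subst (λ y → N[ G ] (v y) x) (≡window k h 2F (≡-sym (m+[n∸m]≡n 2≤ℓ))) x∈N[vℓ])
      where
      k = toℕ ℓ ∸ 2
      h = window-bound 2 2 2≤ℓ (≤-trans (s≤s (s≤s z≤n)) 4≤p) ℓ≤p-2

    N[vℓ]∩N[vℓ′]⊆N[u] : (∀ i → Adj G u (v i)) → 3 ≤ p →
      ∀ ℓ ℓ′ → 1 ≤ toℕ ℓ → toℕ ℓ ≤ p ∸ 2 → toℕ ℓ′ ≡ suc (toℕ ℓ) →
      ∀ x → N[ G ] (v ℓ) x → N[ G ] (v ℓ′) x → N[ G ] u x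
    N[vℓ]∩N[vℓ′]⊆N[u] u~ 3≤p ℓ ℓ′ 1≤ℓ ℓ≤p-2 ℓ′≡ℓ+1 x x∈N[vℓ] x∈N[vℓ′] =
      P4-common-neighbour (window-chordless k h) (λ _ → u~ _)
        (subst (λ y → N[ G ] (v y) x) (≡window k h 1F ℓ≡1+k) x∈N[vℓ])
        (subst (λ y → N[ G ] (v y) x) (≡window k h 2F (trans ℓ′≡ℓ+1 (cong suc ℓ≡1+k))) x∈N[vℓ′])
      where
      k = toℕ ℓ ∸ 1
      h = window-bound 1 2 1≤ℓ (≤-trans (s≤s (s≤s z≤n)) 3≤p) ℓ≤p-2
      ℓ≡1+k = ≡-sym (m+[n∸m]≡n 1≤ℓ)

    N[vℓ]-N⟨v₁⟩-N⟨vₚ₋₁⟩⊆N[u] : (∀ i → 1 ≤ toℕ i → toℕ i ≤ p ∸ 1 → Adj G u (v i)) → 4 ≤ p →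
      ∀ ℓ → 2 ≤ toℕ ℓ → toℕ ℓ ≤ p ∸ 2 → ∀ i j → toℕ i ≡ 1 → toℕ j ≡ p ∸ 1 →
      ∀ x → N[ G ] (v ℓ) x → ¬ (Adj G (v i) x ⊎ Adj G (v j) x) → N[ G ] u x
    N[vℓ]-N⟨v₁⟩-N⟨vₚ₋₁⟩⊆N[u] u~ 4≤p ℓ 2≤ℓ ℓ≤p-2 i j i≡1 j≡p-1 x x∈N[vℓ] x∉N⟨vᵢ⟩∪N⟨vⱼ⟩ =
      P5-centre (window-chordless k h)
        (u~at 1F (s≤s z≤n) (below-4 1F (s≤s z≤n))) (u~at 2F (s≤s z≤n) (below-4 2F (s≤s (s≤s z≤n))))
        (u~at 3F (s≤s z≤n) (below-4 3F ≤-refl)) left-end right-end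
        (subst (λ y → N[ G ] (v y) x) (≡window k h 2F (≡-sym (m+[n∸m]≡n 2≤ℓ))) x∈N[vℓ])
      where
      k = toℕ ℓ ∸ 2
      h = window-bound 2 2 2≤ℓ (≤-trans (s≤s (s≤s z≤n)) 4≤p) ℓ≤p-2
      3+k≤p-1 : 3 + k ≤ p ∸ 1
      3+k≤p-1 = ∸-monoˡ-≤ 1 h
      below-4 : ∀ (t : Fin 5) → toℕ t ≤ 3 → toℕ t + k ≤ p ∸ 1
      below-4 _ t≤3 = ≤-trans (+-monoˡ-≤ k t≤3) 3+k≤p-1
      u~at : ∀ t → 1 ≤ toℕ t + k → toℕ t + k ≤ p ∸ 1 → Adj G u (v (window k h t))
      u~at t lo hi = u~ (window k h t) (subst (1 ≤_) (≡-sym (toℕ-window k h t)) lo)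
                                       (subst (_≤ p ∸ 1) (≡-sym (toℕ-window k h t)) hi)
      left-end : Adj G (v (window k h 1F)) x → Adj G u (v (window k h 0F))
      left-end w₁x with 1 ≤? k
      ... | yes 1≤k = u~at 0F 1≤k (below-4 0F z≤n)
      ... | no 1≰k  = ⊥-elim (x∉N⟨vᵢ⟩∪N⟨vⱼ⟩ (inj₁ (subst (λ y → Adj G (v y) x)
                        (≡-sym (≡window k h 1F (trans i≡1 (cong suc (≡-sym (n<1⇒n≡0 (≰⇒> 1≰k))))))) w₁x)))
      right-end : Adj G (v (window k h 3F)) x → Adj G u (v (window k h 4F))
      right-end w₃x with 4 + k ≤? p ∸ 1
      ... | yes 4+k≤p-1 = u~at 4F (s≤s z≤n) 4+k≤p-1
      ... | no 4+k≰p-1  = ⊥-elim (x∉N⟨vᵢ⟩∪N⟨vⱼ⟩ (inj₂ (subst (λ y → Adj G (v y) x)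
                            (≡-sym (≡window k h 3F (trans j≡p-1 (≤-antisym (≤-pred (≰⇒> 4+k≰p-1)) 3+k≤p-1)))) w₃x)))

proposition4p2 : {n : ℕ} (G : Graph n) → Prereduced G →
    (p : ℕ) (v : Fin (suc p) → Fin n) → ChordlessPath G p v →
    (u : Fin n) →
    (∀ i → 1 ≤ toℕ i → toℕ i ≤ p ∸ 1 → Adj G u (v i)) →
    ((4 ≤ p → Adj G u (v Fin.zero) → Adj G u (v (fromℕ p)) →
        ∀ ℓ → 2 ≤ toℕ ℓ → toℕ ℓ ≤ p ∸ 2 →
          ∀ x → N[_] G (v ℓ) x → N[_] G u x)
    × (3 ≤ p → Adj G u (v Fin.zero) → Adj G u (v (fromℕ p)) →
        ∀ ℓ ℓ′ → 1 ≤ toℕ ℓ → toℕ ℓ ≤ p ∸ 2 → toℕ ℓ′ ≡ suc (toℕ ℓ) →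
          ∀ x → N[_] G (v ℓ) x → N[_] G (v ℓ′) x → N[_] G u x)
    × (4 ≤ p →
        ∀ ℓ → 2 ≤ toℕ ℓ → toℕ ℓ ≤ p ∸ 2 →
          ∀ i j → toℕ i ≡ 1 → toℕ j ≡ p ∸ 1 →
          ∀ x → N[_] G (v ℓ) x → ¬ (N⟨_⟩ G (v i) x ⊎ N⟨_⟩ G (v j) x) → N[_] G u x))
proposition4p2 G prereduced p v cp u u~inner =
    (λ 4≤p u~v₀ u~vₚ → N[vℓ]⊆N[u] G prereduced cp (adjacent-to-all G u~v₀ u~vₚ u~inner) 4≤p)
  , (λ 3≤p u~v₀ u~vₚ → N[vℓ]∩N[vℓ′]⊆N[u] G prereduced cp (adjacent-to-all G u~v₀ u~vₚ u~inner) 3≤p)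
  , N[vℓ]-N⟨v₁⟩-N⟨vₚ₋₁⟩⊆N[u] G prereduced cp u~inner
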